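{- Let $m,n,p$ be positive integers and, for every integer $j$, let $a_j=(m-j)(n-j)(p-j)$ and $b_j=mn+np+mp-j(m+n+p-j)$. Then $$\sum_{i=0}^{p-1}\frac{(-1)^i}{i!}\prod_{j=1}^ia_j\prod_{j=i+1}^{p-1}b_j=p\prod_{j=m+1}^{m+p-1}b_j.$$
   Context: Empty products equal $1$. Note $b_j=(a_0-a_j)/j$ for $j\ne 0$. -}

module Defs where

open import Data.Nat as ℕ using (ℕ; zero; suc; _!)
open import Data.Nat.Properties using (_!≢0)
open import Data.Integer as ℤ using (ℤ; +_)
open import Data.Rational as ℚ using (ℚ)

-- a_j = (m - j)(n - j)(p - j), as an integer (j may exceed m, n, p)
aT : ℕ → ℕ → ℕ → ℕ → ℤ
aT m n p j = ((+ m ℤ.- + j) ℤ.* (+ n ℤ.- + j)) ℤ.* (+ p ℤ.- + j)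

bT : ℕ → ℕ → ℕ → ℕ → ℤ
bT m n p j = (+ (m ℕ.* n ℕ.+ n ℕ.* p ℕ.+ m ℕ.* p))
             ℤ.- (+ j) ℤ.* (+ (m ℕ.+ n ℕ.+ p) ℤ.- + j)

prodFrom : ℕ → ℕ → (ℕ → ℤ) → ℤ
prodFrom lo zero    f = ℤ.1ℤ
prodFrom lo (suc k) f = f lo ℤ.* prodFrom (suc lo) k f

-- ∏_{j=lo}^{hi} f j, with hi < lo giving 1
prodRange : ℕ → ℕ → (ℕ → ℤ) → ℤ
prodRange lo hi f = prodFrom lo (suc hi ℕ.∸ lo) f

sumBelow : ℕ → (ℕ → ℚ) → ℚ
sumBelow zero    g = ℚ.0ℚ
sumBelow (suc k) g = sumBelow k g ℚ.+ g k

signZ : ℕ → ℤ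
signZ zero    = ℤ.1ℤ
signZ (suc i) = ℤ.- signZ i

summand : ℕ → ℕ → ℕ → ℕ → ℚ
summand m n p i =
  ((signZ i ℤ.* prodRange 1 i (aT m n p) ℤ.* prodRange (suc i) (p ℕ.∸ 1) (bT m n p))
     ℚ./ (i !)) {{i !≢0}}

LHS : ℕ → ℕ → ℕ → ℚ
LHS m n p = sumBelow p (summand m n p)

RHS : ℕ → ℕ → ℕ → ℚ
RHS m n p = ((+ p) ℤ.* prodRange (suc m) (m ℕ.+ p ℕ.∸ 1) (bT m n p)) ℚ./ 1

-- Multiplying by (p-1)! clears the denominators, the factor (p-1)!/i! being ∏_{j=i+1}^{p-1} j.
-- For fixed n and p both sides then become polynomials of degree at most p-1 in m, so it
-- suffices to check m = 0, …, p-1. At m = 0 every one of the p terms of the sum equals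
-- ∏_{j=1}^{p-1} j b_j. For 1 ≤ m = r < p, the zero a_r = 0 kills the terms with i ≥ r, and
-- since a_j and b_j are symmetric in m and p, the surviving terms are those of the identity
-- for (m, p) := (p, r) multiplied by ∏_{j=r}^{p-1} j b_j; so induction on p applies, the two
-- right-hand sides being matched by r b_r = r n p = p b_p.
module Submission where

open import Defs
open import Data.Nat as ℕ using (ℕ; zero; suc; _∸_; _!; _≤_; _<_; _≥_; z≤n; s≤s)
import Data.Nat.Properties as ℕP
open import Data.Nat.Properties using (_!≢0)
open import Data.Nat.Induction using (<-rec)
open import Data.Integer as ℤ using (ℤ; +_; _+_; _*_; -_; _-_; 0ℤ; 1ℤ)
import Data.Integer.Properties as ℤP
open import Data.Integer.Tactic.RingSolver using (solve-∀)
open import Data.Product using (_,_)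
open import Data.Sum using (inj₁; inj₂)
import Data.Rational as ℚ
import Data.Rational.Properties as ℚP
import Data.Rational.Unnormalised as ℚᵘ
import Data.Rational.Unnormalised.Properties as ℚᵘP
open import Relation.Binary.PropositionalEquality
  using (_≡_; refl; sym; trans; cong; cong₂; subst; module ≡-Reasoning)
open ≡-Reasoning

sumℤ : ℕ → (ℕ → ℤ) → ℤ
sumℤ zero    g = 0ℤ
sumℤ (suc k) g = sumℤ k g + g k

sumℤ-cong : ∀ k {g h : ℕ → ℤ} → (∀ i → i < k → g i ≡ h i) → sumℤ k g ≡ sumℤ k h
sumℤ-cong zero    e = refl
sumℤ-cong (suc k) e = cong₂ _+_ (sumℤ-cong k (λ i i<k → e i (ℕP.m<n⇒m<1+n i<k))) (e k ℕP.≤-refl)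

sumℤ-const : ∀ k c → sumℤ k (λ _ → c) ≡ + k * c
sumℤ-const zero    c = sym (ℤP.*-zeroˡ c)
sumℤ-const (suc k) c = trans (cong (_+ c) (sumℤ-const k c)) (lemma (+ k) c)
  where lemma : ∀ k c → k * c + c ≡ (1ℤ + k) * c
        lemma = solve-∀

sumℤ-*ʳ : ∀ k (g : ℕ → ℤ) c → sumℤ k g * c ≡ sumℤ k (λ i → g i * c)
sumℤ-*ʳ zero    g c = ℤP.*-zeroˡ c
sumℤ-*ʳ (suc k) g c = trans (ℤP.*-distribʳ-+ c (sumℤ k g) (g k)) (cong (_+ g k * c) (sumℤ-*ʳ k g c))

sumℤ-truncate : ∀ {k} l (g : ℕ → ℤ) → (∀ i → k ≤ i → g i ≡ 0ℤ) → k ≤ l → sumℤ l g ≡ sumℤ k g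
sumℤ-truncate zero g vanish z≤n = refl
sumℤ-truncate {k} (suc l) g vanish k≤1+l with ℕP.m≤n⇒m<n∨m≡n k≤1+l
... | inj₂ refl       = refl
... | inj₁ (s≤s k≤l) = begin
  sumℤ l g + g l  ≡⟨ cong (_+_ (sumℤ l g)) (vanish l k≤l) ⟩
  sumℤ l g + 0ℤ   ≡⟨ ℤP.+-identityʳ _ ⟩
  sumℤ l g        ≡⟨ sumℤ-truncate l g vanish k≤l ⟩
  sumℤ k g        ∎

prodFrom-cong : ∀ lo k {f g : ℕ → ℤ} → (∀ j → f j ≡ g j) → prodFrom lo k f ≡ prodFrom lo k g
prodFrom-cong lo zero    e = refl
prodFrom-cong lo (suc k) e = cong₂ _*_ (e lo) (prodFrom-cong (suc lo) k e)

prodFrom-+ : ∀ lo a b (f : ℕ → ℤ) → prodFrom lo (a ℕ.+ b) f ≡ prodFrom lo a f * prodFrom (lo ℕ.+ a) b f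
prodFrom-+ lo zero    b f =
  trans (cong (λ l → prodFrom l b f) (sym (ℕP.+-identityʳ lo))) (sym (ℤP.*-identityˡ _))
prodFrom-+ lo (suc a) b f = begin
  f lo * prodFrom (suc lo) (a ℕ.+ b) f
    ≡⟨ cong (f lo *_) (prodFrom-+ (suc lo) a b f) ⟩
  f lo * (prodFrom (suc lo) a f * prodFrom (suc lo ℕ.+ a) b f)
    ≡⟨ ℤP.*-assoc (f lo) _ _ ⟨
  f lo * prodFrom (suc lo) a f * prodFrom (suc (lo ℕ.+ a)) b f
    ≡⟨ cong (λ l → f lo * prodFrom (suc lo) a f * prodFrom l b f) (sym (ℕP.+-suc lo a)) ⟩
  f lo * prodFrom (suc lo) a f * prodFrom (lo ℕ.+ suc a) b f  ∎

prodFrom-shift : ∀ a lo k (f : ℕ → ℤ) → prodFrom lo k (λ j → f (j ℕ.+ a)) ≡ prodFrom (lo ℕ.+ a) k f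
prodFrom-shift a lo zero    f = refl
prodFrom-shift a lo (suc k) f = cong (f (lo ℕ.+ a) *_) (prodFrom-shift a (suc lo) k f)

prodFrom-* : ∀ lo k (f g : ℕ → ℤ) → prodFrom lo k (λ j → f j * g j) ≡ prodFrom lo k f * prodFrom lo k g
prodFrom-* lo zero    f g = refl
prodFrom-* lo (suc k) f g = trans (cong (f lo * g lo *_) (prodFrom-* (suc lo) k f g)) (lemma (f lo) (g lo) _ _)
  where lemma : ∀ a b c d → (a * b) * (c * d) ≡ (a * c) * (b * d)
        lemma = solve-∀

prodFrom-zero : ∀ lo t k (f : ℕ → ℤ) → f (lo ℕ.+ t) ≡ 0ℤ → t < k → prodFrom lo k f ≡ 0ℤ
prodFrom-zero lo zero    (suc k) f f≡0 _ =
  trans (cong (_* prodFrom (suc lo) k f) (trans (cong f (sym (ℕP.+-identityʳ lo))) f≡0))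
        (ℤP.*-zeroˡ (prodFrom (suc lo) k f))
prodFrom-zero lo (suc t) (suc k) f f≡0 (s≤s t<k) =
  trans (cong (f lo *_) (prodFrom-zero (suc lo) t k f (trans (cong f (sym (ℕP.+-suc lo t))) f≡0) t<k))
        (ℤP.*-zeroʳ (f lo))

prodFrom-factorial : ∀ a k → prodFrom (suc a) k (λ j → + j) * + (a !) ≡ + ((a ℕ.+ k) !)
prodFrom-factorial a zero    = trans (ℤP.*-identityˡ _) (cong (λ l → + (l !)) (sym (ℕP.+-identityʳ a)))
prodFrom-factorial a (suc k) = begin
  (+ suc a * P) * + (a !)  ≡⟨ lemma (+ suc a) P (+ (a !)) ⟩
  P * (+ suc a * + (a !))  ≡⟨ cong (P *_) (sym (ℤP.pos-* (suc a) (a !))) ⟩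
  P * + (suc a !)          ≡⟨ prodFrom-factorial (suc a) k ⟩
  + ((suc a ℕ.+ k) !)      ≡⟨ cong (λ l → + (l !)) (sym (ℕP.+-suc a k)) ⟩
  + ((a ℕ.+ suc k) !)      ∎
  where
    P = prodFrom (suc (suc a)) k (λ j → + j)
    lemma : ∀ x y z → (x * y) * z ≡ y * (x * z)
    lemma = solve-∀

signZ-*-prodFrom-neg : ∀ lo i (g : ℕ → ℤ) → signZ i * prodFrom lo i (λ j → - g j) ≡ prodFrom lo i g
signZ-*-prodFrom-neg lo zero    g = refl
signZ-*-prodFrom-neg lo (suc i) g =
  trans (lemma (signZ i) (g lo) _) (cong (g lo *_) (signZ-*-prodFrom-neg (suc lo) i g))
  where lemma : ∀ s x r → (- s) * ((- x) * r) ≡ x * (s * r)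
        lemma = solve-∀

Δ : (ℕ → ℤ) → ℕ → ℤ
Δ f x = f (suc x) - f x

Degree≤ : ℕ → (ℕ → ℤ) → Set
Degree≤ zero    f = ∀ x → f (suc x) ≡ f x
Degree≤ (suc d) f = Degree≤ d (Δ f)

Degree≤-resp : ∀ d {f g : ℕ → ℤ} → (∀ x → f x ≡ g x) → Degree≤ d f → Degree≤ d g
Degree≤-resp zero    f≗g df x = trans (sym (f≗g (suc x))) (trans (df x) (f≗g x))
Degree≤-resp (suc d) f≗g df = Degree≤-resp d (λ x → cong₂ _-_ (f≗g (suc x)) (f≗g x)) df

Degree≤-const : ∀ d c → Degree≤ d (λ _ → c)
Degree≤-const zero    c x = refl
Degree≤-const (suc d) c = Degree≤-resp d (λ _ → sym (ℤP.+-inverseʳ c)) (Degree≤-const d 0ℤ)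

Degree≤-+ : ∀ d {f g : ℕ → ℤ} → Degree≤ d f → Degree≤ d g → Degree≤ d (λ x → f x + g x)
Degree≤-+ zero    df dg x = cong₂ _+_ (df x) (dg x)
Degree≤-+ (suc d) {f} {g} df dg =
  Degree≤-resp d (λ x → lemma (f (suc x)) (f x) (g (suc x)) (g x)) (Degree≤-+ d df dg)
  where lemma : ∀ a b c e → (a - b) + (c - e) ≡ (a + c) - (b + e)
        lemma = solve-∀

Degree≤-scale : ∀ d c {f : ℕ → ℤ} → Degree≤ d f → Degree≤ d (λ x → c * f x)
Degree≤-scale zero    c df x = cong (c *_) (df x)
Degree≤-scale (suc d) c {f} df =
  Degree≤-resp d (λ x → lemma c (f (suc x)) (f x)) (Degree≤-scale d c df)
  where lemma : ∀ c a b → c * (a - b) ≡ c * a - c * b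
        lemma = solve-∀

Degree≤-shift : ∀ d {f : ℕ → ℤ} → Degree≤ d f → Degree≤ d (λ x → f (suc x))
Degree≤-shift zero    df x = df (suc x)
Degree≤-shift (suc d) df = Degree≤-shift d df

Degree≤0-const : ∀ {f : ℕ → ℤ} → Degree≤ 0 f → ∀ x → f x ≡ f 0
Degree≤0-const df zero    = refl
Degree≤0-const df (suc x) = trans (df x) (Degree≤0-const df x)

Degree≤-* : ∀ d e {f g : ℕ → ℤ} → Degree≤ d f → Degree≤ e g → Degree≤ (d ℕ.+ e) (λ x → f x * g x)
Degree≤-* zero e {f} {g} df dg =
  Degree≤-resp e (λ x → cong (_* g x) (sym (Degree≤0-const df x))) (Degree≤-scale e (f 0) dg)
Degree≤-* (suc d) zero {f} {g} df dg =
  subst (λ k → Degree≤ k (λ x → f x * g x)) (sym (ℕP.+-identityʳ (suc d)))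
    (Degree≤-resp (suc d) (λ x → trans (ℤP.*-comm (g 0) (f x)) (cong (f x *_) (sym (Degree≤0-const dg x))))
      (Degree≤-scale (suc d) (g 0) df))
-- Product rule: Δ(f g) x = Δf x · g (x+1) + f x · Δg x.
Degree≤-* (suc d) (suc e) {f} {g} df dg =
  Degree≤-resp (d ℕ.+ suc e) (λ x → lemma (f (suc x)) (f x) (g (suc x)) (g x))
    (Degree≤-+ (d ℕ.+ suc e) (Degree≤-* d (suc e) df (Degree≤-shift (suc e) {g} dg))
      (subst (λ k → Degree≤ k (λ x → f x * Δ g x)) (sym (ℕP.+-suc d e)) (Degree≤-* (suc d) e {f} {Δ g} df dg)))
  where lemma : ∀ a b c u → (a - b) * c + b * (c - u) ≡ a * c - b * u
        lemma = solve-∀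

Degree≤-linear : ∀ {f : ℕ → ℤ} A B → (∀ x → f x ≡ A * + x + B) → Degree≤ 1 f
Degree≤-linear {f} A B f≡ x = trans (Δf≡A (suc x)) (sym (Δf≡A x))
  where
    lemma : ∀ A X B → (A * (1ℤ + X) + B) - (A * X + B) ≡ A
    lemma = solve-∀
    Δf≡A : ∀ x → Δ f x ≡ A
    Δf≡A x = trans (cong₂ _-_ (f≡ (suc x)) (f≡ x)) (lemma A (+ x) B)

Degree≤-sumℤ : ∀ d k {G : ℕ → ℕ → ℤ} → (∀ i → i < k → Degree≤ d (λ x → G x i)) →
               Degree≤ d (λ x → sumℤ k (G x))
Degree≤-sumℤ d zero    dG = Degree≤-const d 0ℤ
Degree≤-sumℤ d (suc k) {G} dG =
  Degree≤-+ d (Degree≤-sumℤ d k {G} (λ i i<k → dG i (ℕP.m<n⇒m<1+n i<k))) (dG k ℕP.≤-refl)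

Degree≤-prodFrom : ∀ lo k {F : ℕ → ℕ → ℤ} → (∀ j → Degree≤ 1 (λ x → F x j)) →
                   Degree≤ k (λ x → prodFrom lo k (F x))
Degree≤-prodFrom lo zero    dF = Degree≤-const 0 1ℤ
Degree≤-prodFrom lo (suc k) {F} dF =
  Degree≤-* 1 k {λ x → F x lo} (dF lo) (Degree≤-prodFrom (suc lo) k {F} dF)

Degree≤-agree : ∀ d {f g : ℕ → ℤ} → Degree≤ d f → Degree≤ d g →
                (∀ k → k ≤ d → f k ≡ g k) → ∀ x → f x ≡ g x
Degree≤-agree zero {f} {g} df dg f≡g x = begin
  f x  ≡⟨ Degree≤0-const df x ⟩
  f 0  ≡⟨ f≡g 0 z≤n ⟩
  g 0  ≡⟨ Degree≤0-const dg x ⟨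
  g x  ∎
Degree≤-agree (suc d) {f} {g} df dg f≡g = go
  where
    Δf≡Δg : ∀ x → Δ f x ≡ Δ g x
    Δf≡Δg = Degree≤-agree d df dg
      (λ k k≤d → cong₂ _-_ (f≡g (suc k) (s≤s k≤d)) (f≡g k (ℕP.m≤n⇒m≤1+n k≤d)))
    lemma : ∀ a b → a ≡ b + (a - b)
    lemma = solve-∀
    go : ∀ x → f x ≡ g x
    go zero    = f≡g 0 z≤n
    go (suc x) = begin
      f (suc x)        ≡⟨ lemma (f (suc x)) (f x) ⟩
      f x + Δ f x      ≡⟨ cong₂ _+_ (go x) (Δf≡Δg x) ⟩
      g x + Δ g x      ≡⟨ lemma (g (suc x)) (g x) ⟨
      g (suc x)        ∎

jbT : ℕ → ℕ → ℕ → ℕ → ℤ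
jbT m n p j = + j * bT m n p j

-- (p-1)! times the i-th summand, where p = q + 1.
clearedTerm : ℕ → ℕ → ℕ → ℕ → ℤ
clearedTerm m n q i =
  signZ i * prodFrom 1 i (aT m n (suc q)) * prodFrom (suc i) (q ∸ i) (jbT m n (suc q))

clearedLHS : ℕ → ℕ → ℕ → ℤ
clearedLHS m n q = sumℤ (suc q) (clearedTerm m n q)

clearedRHS : ℕ → ℕ → ℕ → ℤ
clearedRHS m n q = + (q !) * (+ suc q * prodFrom (suc m) q (bT m n (suc q)))

bT-expand : ∀ m n p j → bT m n p j ≡ ((+ m * + n + + n * + p) + + m * + p) - + j * (((+ m + + n) + + p) - + j)
bT-expand m n p j = cong₂ (λ u v → u - + j * (v - + j)) pairwise sum
  where
    pairwise : + (m ℕ.* n ℕ.+ n ℕ.* p ℕ.+ m ℕ.* p) ≡ (+ m * + n + + n * + p) + + m * + p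
    pairwise = trans (ℤP.pos-+ (m ℕ.* n ℕ.+ n ℕ.* p) (m ℕ.* p))
      (cong₂ _+_ (trans (ℤP.pos-+ (m ℕ.* n) (n ℕ.* p)) (cong₂ _+_ (ℤP.pos-* m n) (ℤP.pos-* n p)))
                 (ℤP.pos-* m p))
    sum : + (m ℕ.+ n ℕ.+ p) ≡ (+ m + + n) + + p
    sum = trans (ℤP.pos-+ (m ℕ.+ n) p) (cong (_+ + p) (ℤP.pos-+ m n))

aT-swap : ∀ m n p j → aT m n p j ≡ aT p n m j
aT-swap m n p j = lemma (+ m) (+ n) (+ p) (+ j)
  where lemma : ∀ M N P J → ((M - J) * (N - J)) * (P - J) ≡ ((P - J) * (N - J)) * (M - J)
        lemma = solve-∀

bT-swap : ∀ m n p j → bT m n p j ≡ bT p n m j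
bT-swap m n p j = begin
  bT m n p j                                                     ≡⟨ bT-expand m n p j ⟩
  ((M * N + N * P) + M * P) - J * (((M + N) + P) - J)            ≡⟨ lemma M N P J ⟩
  ((P * N + N * M) + P * M) - J * (((P + N) + M) - J)            ≡⟨ bT-expand p n m j ⟨
  bT p n m j                                                     ∎
  where
    M = + m; N = + n; P = + p; J = + j
    lemma : ∀ M N P J → ((M * N + N * P) + M * P) - J * (((M + N) + P) - J)
                      ≡ ((P * N + N * M) + P * M) - J * (((P + N) + M) - J)
    lemma = solve-∀

aT-root : ∀ m n p → aT m n p m ≡ 0ℤ
aT-root m n p = cong (λ x → x * (+ n - + m) * (+ p - + m)) (ℤP.+-inverseʳ (+ m))

-- Both equal m n p, since b_m = n p and b_p = m n.
jbT-m≡jbT-p : ∀ m n p → jbT m n p m ≡ jbT m n p p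
jbT-m≡jbT-p m n p = begin
  + m * bT m n p m  ≡⟨ cong (+ m *_) (bT-expand m n p m) ⟩
  M * (((M * N + N * P) + M * P) - M * (((M + N) + P) - M))  ≡⟨ lemma M N P ⟩
  P * (((M * N + N * P) + M * P) - P * (((M + N) + P) - P))  ≡⟨ cong (+ p *_) (bT-expand m n p p) ⟨
  + p * bT m n p p  ∎
  where
    M = + m; N = + n; P = + p
    lemma : ∀ M N P → M * (((M * N + N * P) + M * P) - M * (((M + N) + P) - M))
                    ≡ P * (((M * N + N * P) + M * P) - P * (((M + N) + P) - P))
    lemma = solve-∀

aT-linear : ∀ n p j → Degree≤ 1 (λ m → aT m n p j)
aT-linear n p j = Degree≤-linear ((N - J) * (P - J)) ((- J) * ((N - J) * (P - J))) (λ m → lemma (+ m) N P J)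
  where
    N = + n; P = + p; J = + j
    lemma : ∀ M N P J → ((M - J) * (N - J)) * (P - J) ≡ ((N - J) * (P - J)) * M + (- J) * ((N - J) * (P - J))
    lemma = solve-∀

jbT-linear : ∀ n p j → Degree≤ 1 (λ m → jbT m n p j)
jbT-linear n p j =
  Degree≤-linear (J * ((N + P) - J)) (J * (N * P - J * ((N + P) - J)))
    (λ m → trans (cong (J *_) (bT-expand m n p j)) (lemma (+ m) N P J))
  where
    N = + n; P = + p; J = + j
    lemma : ∀ M N P J → J * (((M * N + N * P) + M * P) - J * (((M + N) + P) - J))
                      ≡ (J * ((N + P) - J)) * M + J * (N * P - J * ((N + P) - J))
    lemma = solve-∀

bT-diagonal-linear : ∀ n p k → Degree≤ 1 (λ m → bT m n p (k ℕ.+ m))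
bT-diagonal-linear n p k =
  Degree≤-linear K (N * P - K * ((N + P) - K)) (λ m → begin
    bT m n p (k ℕ.+ m)
      ≡⟨ bT-expand m n p (k ℕ.+ m) ⟩
    ((+ m * N + N * P) + + m * P) - + (k ℕ.+ m) * (((+ m + N) + P) - + (k ℕ.+ m))
      ≡⟨ cong (λ u → ((+ m * N + N * P) + + m * P) - u * (((+ m + N) + P) - u)) (ℤP.pos-+ k m) ⟩
    ((+ m * N + N * P) + + m * P) - (K + + m) * (((+ m + N) + P) - (K + + m))
      ≡⟨ lemma (+ m) N P K ⟩
    K * + m + (N * P - K * ((N + P) - K))  ∎)
  where
    N = + n; P = + p; K = + k
    lemma : ∀ M N P K → ((M * N + N * P) + M * P) - (K + M) * (((M + N) + P) - (K + M))
                      ≡ K * M + (N * P - K * ((N + P) - K))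
    lemma = solve-∀

Degree≤-clearedLHS : ∀ q n → Degree≤ q (λ m → clearedLHS m n q)
Degree≤-clearedLHS q n = Degree≤-sumℤ q (suc q) term
  where
    term : ∀ i → i < suc q → Degree≤ q (λ m → clearedTerm m n q i)
    term i (s≤s i≤q) = subst (λ d → Degree≤ d (λ m → clearedTerm m n q i)) (ℕP.m+[n∸m]≡n i≤q)
      (Degree≤-* i (q ∸ i)
        (Degree≤-scale i (signZ i) (Degree≤-prodFrom 1 i (aT-linear n (suc q))))
        (Degree≤-prodFrom (suc i) (q ∸ i) (jbT-linear n (suc q))))

Degree≤-clearedRHS : ∀ q n → Degree≤ q (λ m → clearedRHS m n q)
Degree≤-clearedRHS q n =
  Degree≤-scale q (+ (q !)) (Degree≤-scale q (+ suc q)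
    (Degree≤-resp q (λ m → prodFrom-shift m 1 q (bT m n (suc q)))
      (Degree≤-prodFrom 1 q (λ k → bT-diagonal-linear n (suc q) k))))

aT-at-0 : ∀ n p j → aT 0 n p j ≡ - jbT 0 n p j
aT-at-0 n p j = trans (lemma (+ n) (+ p) (+ j)) (cong (λ x → - (+ j * x)) (sym (bT-expand 0 n p j)))
  where lemma : ∀ N P J → ((+ 0 - J) * (N - J)) * (P - J)
                        ≡ - (J * (((+ 0 * N + N * P) + + 0 * P) - J * (((+ 0 + N) + P) - J)))
        lemma = solve-∀

clearedTerm-at-0 : ∀ {q} n {i} → i ≤ q → clearedTerm 0 n q i ≡ prodFrom 1 q (jbT 0 n (suc q))
clearedTerm-at-0 {q} n {i} i≤q = begin
  signZ i * prodFrom 1 i (aT 0 n (suc q)) * prodFrom (suc i) (q ∸ i) g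
    ≡⟨ cong (λ x → signZ i * x * prodFrom (suc i) (q ∸ i) g) (prodFrom-cong 1 i (aT-at-0 n (suc q))) ⟩
  signZ i * prodFrom 1 i (λ j → - g j) * prodFrom (suc i) (q ∸ i) g
    ≡⟨ cong (_* prodFrom (suc i) (q ∸ i) g) (signZ-*-prodFrom-neg 1 i g) ⟩
  prodFrom 1 i g * prodFrom (suc i) (q ∸ i) g
    ≡⟨ prodFrom-+ 1 i (q ∸ i) g ⟨
  prodFrom 1 (i ℕ.+ (q ∸ i)) g
    ≡⟨ cong (λ k → prodFrom 1 k g) (ℕP.m+[n∸m]≡n i≤q) ⟩
  prodFrom 1 q g  ∎
  where g = jbT 0 n (suc q)

cleared-at-0 : ∀ q n → clearedLHS 0 n q ≡ clearedRHS 0 n q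
cleared-at-0 q n = begin
  sumℤ (suc q) (clearedTerm 0 n q)
    ≡⟨ sumℤ-cong (suc q) (λ { i (s≤s i≤q) → clearedTerm-at-0 n i≤q }) ⟩
  sumℤ (suc q) (λ _ → prodFrom 1 q (jbT 0 n (suc q)))
    ≡⟨ sumℤ-const (suc q) _ ⟩
  + suc q * prodFrom 1 q (jbT 0 n (suc q))
    ≡⟨ cong (+ suc q *_) (prodFrom-* 1 q +_ b) ⟩
  + suc q * (prodFrom 1 q (λ j → + j) * B)
    ≡⟨ cong (λ x → + suc q * (x * B)) q!≡ ⟩
  + suc q * (+ (q !) * B)
    ≡⟨ lemma (+ suc q) (+ (q !)) B ⟩
  + (q !) * (+ suc q * B)  ∎
  where
    b = bT 0 n (suc q)
    B = prodFrom 1 q b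
    q!≡ : prodFrom 1 q (λ j → + j) ≡ + (q !)
    q!≡ = trans (sym (ℤP.*-identityʳ _)) (prodFrom-factorial 0 q)
    lemma : ∀ a b c → a * (b * c) ≡ b * (a * c)
    lemma = solve-∀

jbT-swap : ∀ m n p j → jbT m n p j ≡ jbT p n m j
jbT-swap m n p j = cong (+ j *_) (bT-swap m n p j)

clearedTerm-root : ∀ s n q i → suc s ≤ i → clearedTerm (suc s) n q i ≡ 0ℤ
clearedTerm-root s n q i s<i = begin
  signZ i * prodFrom 1 i (aT (suc s) n (suc q)) * X  ≡⟨ cong (λ x → signZ i * x * X) A≡0 ⟩
  signZ i * 0ℤ * X                                   ≡⟨ cong (_* X) (ℤP.*-zeroʳ (signZ i)) ⟩
  0ℤ * X                                             ≡⟨ ℤP.*-zeroˡ X ⟩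
  0ℤ                                                 ∎
  where
    X = prodFrom (suc i) (q ∸ i) (jbT (suc s) n (suc q))
    A≡0 : prodFrom 1 i (aT (suc s) n (suc q)) ≡ 0ℤ
    A≡0 = prodFrom-zero 1 s i (aT (suc s) n (suc q)) (aT-root (suc s) n (suc q)) s<i

-- ∏_{j=r}^{q} j b_j for m = r = s + 1 and p = q + 1, where q = r + t.
reflectionFactor : ℕ → ℕ → ℕ → ℤ
reflectionFactor s t n = prodFrom (suc s) (suc t) (jbT (suc s) n (suc (suc s ℕ.+ t)))

clearedTerm-reflect : ∀ s t n {i} → i ≤ s →
  clearedTerm (suc s) n (suc s ℕ.+ t) i ≡ clearedTerm (suc (suc s ℕ.+ t)) n s i * reflectionFactor s t n
clearedTerm-reflect s t n {i} i≤s = begin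
  S * prodFrom 1 i (aT r n p) * prodFrom (suc i) (q ∸ i) (jbT r n p)
    ≡⟨ cong (S * prodFrom 1 i (aT r n p) *_) jb-split ⟩
  S * prodFrom 1 i (aT r n p) * (prodFrom (suc i) (s ∸ i) (jbT r n p) * K)
    ≡⟨ cong₂ (λ x y → S * x * (y * K)) (prodFrom-cong 1 i (aT-swap r n p))
                                        (prodFrom-cong (suc i) (s ∸ i) (jbT-swap r n p)) ⟩
  S * prodFrom 1 i (aT p n r) * (prodFrom (suc i) (s ∸ i) (jbT p n r) * K)
    ≡⟨ ℤP.*-assoc (S * prodFrom 1 i (aT p n r)) _ K ⟨
  S * prodFrom 1 i (aT p n r) * prodFrom (suc i) (s ∸ i) (jbT p n r) * K  ∎
  where
    r = suc s
    q = suc s ℕ.+ t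
    p = suc q
    S = signZ i
    K = reflectionFactor s t n
    jb = jbT r n p
    jb-split : prodFrom (suc i) (q ∸ i) jb ≡ prodFrom (suc i) (s ∸ i) jb * K
    jb-split = begin
      prodFrom (suc i) (q ∸ i) jb
        ≡⟨ cong (λ k → prodFrom (suc i) k jb)
                (trans (cong (_∸ i) (sym (ℕP.+-suc s t))) (ℕP.+-∸-comm (suc t) i≤s)) ⟩
      prodFrom (suc i) ((s ∸ i) ℕ.+ suc t) jb
        ≡⟨ prodFrom-+ (suc i) (s ∸ i) (suc t) jb ⟩
      prodFrom (suc i) (s ∸ i) jb * prodFrom (suc (i ℕ.+ (s ∸ i))) (suc t) jb
        ≡⟨ cong (λ l → prodFrom (suc i) (s ∸ i) jb * prodFrom (suc l) (suc t) jb) (ℕP.m+[n∸m]≡n i≤s) ⟩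
      prodFrom (suc i) (s ∸ i) jb * K  ∎

clearedRHS-reflect : ∀ s t n →
  clearedRHS (suc (suc s ℕ.+ t)) n s * reflectionFactor s t n ≡ clearedRHS (suc s) n (suc s ℕ.+ t)
clearedRHS-reflect s t n = begin
  (+ (s !) * (+ r * prodFrom (suc p) s (bT p n r))) * K
    ≡⟨ cong₂ (λ x y → (+ (s !) * (+ r * x)) * y) B₁-swap K-split ⟩
  (+ (s !) * (+ r * B₁)) * (J * (b r * M))
    ≡⟨ lemma₁ (+ (s !)) (+ r) B₁ J (b r) M ⟩
  (+ (s !) * J * B₁ * M) * (+ r * b r)
    ≡⟨ cong (+ (s !) * J * B₁ * M *_) (jbT-m≡jbT-p r n p) ⟩
  (+ (s !) * J * B₁ * M) * (+ p * b p)
    ≡⟨ lemma₂ (+ (s !)) (+ p) B₁ J (b p) M ⟩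
  (J * + (s !)) * (+ p * (M * (b p * B₁)))
    ≡⟨ cong₂ (λ x y → x * (+ p * y)) q!-split B-split ⟨
  + (q !) * (+ p * prodFrom (suc r) q b)  ∎
  where
    r = suc s
    q = suc s ℕ.+ t
    p = suc q
    b = bT r n p
    K = reflectionFactor s t n
    J = prodFrom r (suc t) (λ j → + j)
    M = prodFrom (suc r) t b
    B₁ = prodFrom (suc p) s b
    B₁-swap : prodFrom (suc p) s (bT p n r) ≡ B₁
    B₁-swap = prodFrom-cong (suc p) s (λ j → bT-swap p n r j)
    K-split : K ≡ J * (b r * M)
    K-split = prodFrom-* r (suc t) +_ b
    B-split : prodFrom (suc r) q b ≡ M * (b p * B₁)
    B-split = trans (cong (λ k → prodFrom (suc r) k b) (ℕP.+-comm (suc s) t)) (prodFrom-+ (suc r) t (suc s) b)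
    q!-split : + (q !) ≡ J * + (s !)
    q!-split = trans (cong (λ k → + (k !)) (sym (ℕP.+-suc s t))) (sym (prodFrom-factorial s (suc t)))
    lemma₁ : ∀ S R B J br M → (S * (R * B)) * (J * (br * M)) ≡ (S * J * B * M) * (R * br)
    lemma₁ = solve-∀
    lemma₂ : ∀ S P B J bp M → (S * J * B * M) * (P * bp) ≡ (J * S) * (P * (M * (bp * B)))
    lemma₂ = solve-∀

cleared-reflect : ∀ s t n →
  clearedLHS (suc (suc s ℕ.+ t)) n s ≡ clearedRHS (suc (suc s ℕ.+ t)) n s →
  clearedLHS (suc s) n (suc s ℕ.+ t) ≡ clearedRHS (suc s) n (suc s ℕ.+ t)
cleared-reflect s t n ih = begin
  sumℤ (suc q) (clearedTerm r n q)
    ≡⟨ sumℤ-truncate (suc q) _ (clearedTerm-root s n q) (ℕP.m≤n⇒m≤1+n (ℕP.m≤m+n r t)) ⟩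
  sumℤ r (clearedTerm r n q)
    ≡⟨ sumℤ-cong r (λ { i (s≤s i≤s) → clearedTerm-reflect s t n i≤s }) ⟩
  sumℤ r (λ i → clearedTerm p n s i * K)
    ≡⟨ sumℤ-*ʳ r (clearedTerm p n s) K ⟨
  clearedLHS p n s * K
    ≡⟨ cong (_* K) ih ⟩
  clearedRHS p n s * K
    ≡⟨ clearedRHS-reflect s t n ⟩
  clearedRHS r n q  ∎
  where
    r = suc s
    q = suc s ℕ.+ t
    p = suc q
    K = reflectionFactor s t n

cleared-identity : ∀ q m n → clearedLHS m n q ≡ clearedRHS m n q
cleared-identity = <-rec _ step
  where
    step : ∀ q → (∀ {s} → s < q → ∀ m n → clearedLHS m n s ≡ clearedRHS m n s) →
           ∀ m n → clearedLHS m n q ≡ clearedRHS m n q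
    step q ih m n = Degree≤-agree q (Degree≤-clearedLHS q n) (Degree≤-clearedRHS q n) agree m
      where
        agree : ∀ k → k ≤ q → clearedLHS k n q ≡ clearedRHS k n q
        agree zero    _ = cleared-at-0 q n
        agree (suc s) r≤q with ℕP.m≤n⇒∃[o]m+o≡n r≤q
        ... | t , refl = cleared-reflect s t n (ih (s≤s (ℕP.m≤m+n s t)) (suc (suc s ℕ.+ t)) n)

toℚᵘ-/ : ∀ a d .{{_ : ℕ.NonZero d}} → ℚ.toℚᵘ (a ℚ./ d) ℚᵘ.≃ ℚᵘ.mkℚᵘ a (ℕ.pred d)
toℚᵘ-/ a (suc d) = ℚP.toℚᵘ-fromℚᵘ (ℚᵘ.mkℚᵘ a d)

/-cross : ∀ a b d e .{{_ : ℕ.NonZero d}} .{{_ : ℕ.NonZero e}} → a * + e ≡ b * + d → a ℚ./ d ≡ b ℚ./ e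
/-cross a b d@(suc _) e@(suc _) eq =
  ℚP.toℚᵘ-injective
    (ℚᵘP.≃-trans (toℚᵘ-/ a d) (ℚᵘP.≃-trans (ℚᵘ.*≡* eq) (ℚᵘP.≃-sym (toℚᵘ-/ b e))))

/-+-/ : ∀ a b d .{{_ : ℕ.NonZero d}} → (a ℚ./ d) ℚ.+ (b ℚ./ d) ≡ (a + b) ℚ./ d
/-+-/ a b d@(suc _) =
  ℚP.toℚᵘ-injective
    (ℚᵘP.≃-trans (ℚP.toℚᵘ-homo-+ (a ℚ./ d) (b ℚ./ d))
    (ℚᵘP.≃-trans (ℚᵘP.+-cong (toℚᵘ-/ a d) (toℚᵘ-/ b d))
    (ℚᵘP.≃-trans (ℚᵘ.*≡* cross) (ℚᵘP.≃-sym (toℚᵘ-/ (a + b) d)))))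
  where
    lemma : ∀ a b D → (a * D + b * D) * D ≡ (a + b) * (D * D)
    lemma = solve-∀
    cross : (a * + d + b * + d) * + d ≡ (a + b) * + (d ℕ.* d)
    cross = trans (lemma a b (+ d)) (cong ((a + b) *_) (sym (ℤP.pos-* d d)))

sumBelow-/ : ∀ k {f : ℕ → ℚ.ℚ} {g : ℕ → ℤ} d .{{_ : ℕ.NonZero d}} →
             (∀ i → i < k → f i ≡ g i ℚ./ d) → sumBelow k f ≡ sumℤ k g ℚ./ d
sumBelow-/ zero    d _  = sym (ℚP.0/n≡0 d)
sumBelow-/ (suc k) {g = g} d f≡ =
  trans (cong₂ ℚ._+_ (sumBelow-/ k {g = g} d (λ i i<k → f≡ i (ℕP.m<n⇒m<1+n i<k))) (f≡ k ℕP.≤-refl))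
        (/-+-/ (sumℤ k g) (g k) d)

summand≡clearedTerm/ : ∀ m n {q i} → i ≤ q →
                       summand m n (suc q) i ≡ (clearedTerm m n q i ℚ./ (q !)) {{q !≢0}}
summand≡clearedTerm/ m n {q} {i} i≤q =
  /-cross (S * A * B) (clearedTerm m n q i) (i !) (q !) {{i !≢0}} {{q !≢0}} (begin
    S * A * B * + (q !)            ≡⟨ cong (S * A * B *_) q!-split ⟩
    S * A * B * (F * + (i !))      ≡⟨ lemma S A B F (+ (i !)) ⟩
    S * A * (F * B) * + (i !)      ≡⟨ cong (λ x → S * A * x * + (i !)) (prodFrom-* (suc i) (q ∸ i) +_ b) ⟨
    clearedTerm m n q i * + (i !)  ∎)
  where
    S = signZ i
    A = prodFrom 1 i (aT m n (suc q))
    b = bT m n (suc q)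
    B = prodFrom (suc i) (q ∸ i) b
    F = prodFrom (suc i) (q ∸ i) (λ j → + j)
    q!-split : + (q !) ≡ F * + (i !)
    q!-split = sym (trans (prodFrom-factorial i (q ∸ i)) (cong (λ k → + (k !)) (ℕP.m+[n∸m]≡n i≤q)))
    lemma : ∀ S A B F I → S * A * B * (F * I) ≡ S * A * (F * B) * I
    lemma = solve-∀

LHS≡clearedLHS/ : ∀ m n q → LHS m n (suc q) ≡ (clearedLHS m n q ℚ./ (q !)) {{q !≢0}}
LHS≡clearedLHS/ m n q =
  sumBelow-/ (suc q) (q !) {{q !≢0}} (λ { i (s≤s i≤q) → summand≡clearedTerm/ m n i≤q })

RHS≡clearedRHS/ : ∀ m n q → RHS m n (suc q) ≡ (clearedRHS m n q ℚ./ (q !)) {{q !≢0}}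
RHS≡clearedRHS/ m n q =
  /-cross (+ suc q * prodRange (suc m) (m ℕ.+ suc q ∸ 1) b) (clearedRHS m n q) 1 (q !) {{_}} {{q !≢0}} (begin
    + suc q * prodFrom (suc m) (m ℕ.+ suc q ∸ 1 ∸ m) b * + (q !)
      ≡⟨ cong (λ k → + suc q * prodFrom (suc m) k b * + (q !)) length ⟩
    + suc q * prodFrom (suc m) q b * + (q !)
      ≡⟨ lemma (+ suc q) (prodFrom (suc m) q b) (+ (q !)) ⟩
    clearedRHS m n q * + 1  ∎)
  where
    b = bT m n (suc q)
    length : m ℕ.+ suc q ∸ 1 ∸ m ≡ q
    length = trans (cong (λ k → k ∸ 1 ∸ m) (ℕP.+-suc m q)) (ℕP.m+n∸m≡n m q)
    lemma : ∀ P X F → P * X * F ≡ F * (P * X) * + 1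
    lemma = solve-∀

lemma8 : (m n p : ℕ) → m ≥ 1 → n ≥ 1 → p ≥ 1 →
         LHS m n p ≡ RHS m n p
lemma8 m n (suc q) _ _ _ = begin
  LHS m n (suc q)                       ≡⟨ LHS≡clearedLHS/ m n q ⟩
  (clearedLHS m n q ℚ./ q !) {{q !≢0}}  ≡⟨ cong (λ x → (x ℚ./ q !) {{q !≢0}}) (cleared-identity q m n) ⟩
  (clearedRHS m n q ℚ./ q !) {{q !≢0}}  ≡⟨ RHS≡clearedRHS/ m n q ⟨
  RHS m n (suc q)                       ∎
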